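{- Let $\Phi$ be of type $A_{n-1}$. The map $$\epsilon:\mathsf{Park}_\Phi\to\mathcal{D}_n,\qquad [w,J]\mapsto(w',D(J)),$$ where $w'\in wW_J$ is the unique representative with $w'(\mathrm{ind}(J))\subseteq\Phi^+$, is a bijection.
   Context: Type $A_{n-1}$: $\Phi=\{e_i-e_j:i\ne j\in[n]\}$, $\Phi^+=\{e_i-e_j:i<j\}$, simple roots $e_i-e_{i+1}$, $W=S_n$ acting by permuting coordinates ($w(e_i)=e_{w(i)}$); reflection $s_{e_i-e_j}$ is the transposition $(ij)$. Root order: $\alpha\le\beta$ iff $\beta-\alpha$ is a sum of positive roots; an order filter is an up-closed subset $J\subseteq\Phi^+$. $\mathrm{ind}(J)$ is the set of minimal elements of $J$, and $W_J=\langle s_\alpha:\alpha\in\mathrm{ind}(J)\rangle$; each coset $wW_J$ contains a unique $w'$ with $w'(\mathrm{ind}(J))\subseteq\Phi^+$. $\mathsf{Park}_\Phi$ is the set of equivalence classes $[w,J]$ of pairs ($w\in S_n$, $J$ an order filter) under $(w_1,J_1)\sim(w_2,J_2)$ iff $J_1=J_2$ and $w_1W_{J_1}=w_2W_{J_1}$. A Dyck path of length $n$ is a lattice path of North and East unit steps from $(0,0)$ to $(n,n)$ never going below $y=x$. A valley of $D$ is a pair $(i,j)$ such that the $i$-th East step of $D$ is immediately followed by its $j$-th North step. $\mathcal{D}_n$ is the set of pairs $(w,D)$ with $w\in S_n$ and $D$ a Dyck path of length $n$ such that $w(i)<w(j)$ whenever $(i,j)$ is a valley of $D$. For an order filter $J$,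 $D(J)$ is the Dyck path such that, for $1\le i<j\le n$, the unit box with top-right corner $(i,j)$ lies above $D(J)$ if and only if $e_i-e_j\in J$. -}

module Defs where

open import Data.Bool using (Bool; true; false; if_then_else_)
open import Data.Nat as ℕ using (ℕ; zero; suc)
open import Data.Fin using (Fin; toℕ; _≟_; _<_)
open import Data.Fin.Permutation using (Permutation′; _⟨$⟩ʳ_; _⟨$⟩ˡ_)
open import Data.Integer as ℤ using (ℤ)
open import Data.List using (List; []; _∷_; take; length)
open import Data.List.Relation.Unary.All using (All)
open import Data.List.Membership.Propositional using (_∈_)
open import Data.Maybe using (Maybe; just; nothing)
open import Data.Product using (Σ; ∃; _×_; _,_; proj₁; proj₂)
open import Relation.Nullary using (does)
open import Relation.Binary.PropositionalEquality using (_≡_)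

-- Conventions: indices are 0-based, Fin n = {0,…,n-1} stands for [n].
-- The positive root e_i - e_j (i<j) is represented by the pair (i , j).

δ : ∀ {n} → Fin n → Fin n → ℤ
δ i k = if does (k ≟ i) then ℤ.1ℤ else ℤ.0ℤ

root : ∀ {n} → Fin n → Fin n → (Fin n → ℤ)
root i j k = δ i k ℤ.- δ j k

sumRoots : ∀ {n} → List (Fin n × Fin n) → (Fin n → ℤ)
sumRoots [] k = ℤ.0ℤ
sumRoots ((i , j) ∷ ps) k = root i j k ℤ.+ sumRoots ps k

IsPos : ∀ {n} → Fin n × Fin n → Set
IsPos (i , j) = i < j

RootLe : ∀ {n} → Fin n × Fin n → Fin n × Fin n → Set
RootLe {n} (i , j) (k , l) =
  Σ (List (Fin n × Fin n)) λ ps → All IsPos ps ×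
    (∀ x → root k l x ℤ.- root i j x ≡ sumRoots ps x)

-- A subset J ⊆ Φ⁺ is given by its characteristic function; only the values
-- at pairs i < j are meaningful.
Sub : ℕ → Set
Sub n = Fin n → Fin n → Bool

InJ : ∀ {n} → Sub n → Fin n → Fin n → Set
InJ J i j = i < j × J i j ≡ true

SameSub : ∀ {n} → Sub n → Sub n → Set
SameSub {n} J₁ J₂ = ∀ (i j : Fin n) → i < j → J₁ i j ≡ J₂ i j

IsFilter : ∀ {n} → Sub n → Set
IsFilter {n} J = ∀ (i j k l : Fin n) → InJ J i j → k < l →
  RootLe (i , j) (k , l) → InJ J k l

InInd : ∀ {n} → Sub n → Fin n → Fin n → Set
InInd {n} J i j = InJ J i j ×
  (∀ (k l : Fin n) → InJ J k l → RootLe (k , l) (i , j) → (k ≡ i × l ≡ j))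

swap : ∀ {n} → Fin n → Fin n → Fin n → Fin n
swap a b x = if does (x ≟ a) then b else (if does (x ≟ b) then a else x)

-- σ ∈ W_J = ⟨ s_α : α ∈ ind(J) ⟩ (σ given as a function, up to pointwise
-- equality; it is a product of generators s_α)
data InW {n} (J : Sub n) : (Fin n → Fin n) → Set where
  w-id   : ∀ {σ} → (∀ x → σ x ≡ x) → InW J σ
  w-step : ∀ {σ τ} (a b : Fin n) → InInd J a b → InW J σ →
           (∀ x → τ x ≡ σ (swap a b x)) → InW J τ

SameCoset : ∀ {n} → Sub n → Permutation′ n → Permutation′ n → Set
SameCoset J w₁ w₂ = InW J (λ x → w₁ ⟨$⟩ˡ (w₂ ⟨$⟩ʳ x))

-- w' ∈ w W_J and w'(ind J) ⊆ Φ⁺   (w(e_i - e_j) = e_{w i} - e_{w j})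
IsRep : ∀ {n} → Sub n → Permutation′ n → Permutation′ n → Set
IsRep {n} J w w' = SameCoset J w w' ×
  (∀ (i j : Fin n) → InInd J i j → (w' ⟨$⟩ʳ i) < (w' ⟨$⟩ʳ j))

PermEq : ∀ {n} → Permutation′ n → Permutation′ n → Set
PermEq {n} w v = ∀ (i : Fin n) → w ⟨$⟩ʳ i ≡ v ⟨$⟩ʳ i

data Step : Set where
  N E : Step

countN : List Step → ℕ
countN [] = 0
countN (N ∷ s) = suc (countN s)
countN (E ∷ s) = countN s

countE : List Step → ℕ
countE [] = 0
countE (N ∷ s) = countE s
countE (E ∷ s) = suc (countE s)

IsDyck : ℕ → List Step → Set
IsDyck n D = countN D ≡ n × countE D ≡ n ×
  (∀ k → countE (take k D) ℕ.≤ countN (take k D))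

-- heights h D m: list of the y-coordinates of the East steps of D, in order
-- (m = number of North steps already taken)
heights : List Step → ℕ → List ℕ
heights [] m = []
heights (N ∷ s) m = heights s (suc m)
heights (E ∷ s) m = m ∷ heights s m

nth : List ℕ → ℕ → Maybe ℕ
nth [] k = nothing
nth (x ∷ xs) zero = just x
nth (x ∷ xs) (suc k) = nth xs k

-- (0-based i < j) the unit box with top-right corner (i+1 , j+1) lies above D:
-- the (i+1)-th East step of D runs at height h ≤ j.
BoxAbove : ∀ {n} → List Step → Fin n → Fin n → Set
BoxAbove D i j = Σ ℕ λ h → nth (heights D 0) (toℕ i) ≡ just h × h ℕ.≤ toℕ j

-- valleys, 0-based: (e , m) ∈ valleys D 0 0 iff the (e+1)-th East step of D
-- is immediately followed by the (m+1)-th North step.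
valleys : List Step → ℕ → ℕ → List (ℕ × ℕ)
valleys [] e m = []
valleys (N ∷ s) e m = valleys s e (suc m)
valleys (E ∷ []) e m = []
valleys (E ∷ E ∷ s) e m = valleys (E ∷ s) (suc e) m
valleys (E ∷ N ∷ s) e m = (e , m) ∷ valleys (N ∷ s) (suc e) m

IsDJ : ∀ {n} → Sub n → List Step → Set
IsDJ {n} J D = IsDyck n D ×
  (∀ (i j : Fin n) → i < j → (BoxAbove D i j → InJ J i j) × (InJ J i j → BoxAbove D i j))

InDn : ∀ {n} → Permutation′ n → List Step → Set
InDn {n} w D = IsDyck n D ×
  (∀ (i j : Fin n) → (toℕ i , toℕ j) ∈ valleys D 0 0 → (w ⟨$⟩ʳ i) < (w ⟨$⟩ʳ j))

module Submission where

-- The proof reads an order filter J through the height sequence of its Dyck path: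
--  1. For positive roots, e_k - e_l ≤ e_i - e_j iff [k , l] ⊆ [i , j]; the hard direction tests
--     the difference of the roots against the prefix-sum functionals, which are ≥ 0 on Φ⁺.
--  2. A lattice path is determined by the heights of its East steps; the Dyck condition,
--     valleys and the construction of a path with given heights are expressed through them.
--  3. The rows of a filter J are final segments [rowStart J i , n), with rowStart weakly
--     increasing; D(J) is the path with these heights, and any D(J) must have them (uniqueness).
--  4. The valleys of D(J) and the minimal elements ind(J) are both the corners of this
--     height sequence; conversely the boxes above any Dyck path D form a filter J with D = D(J).
--  5. ind(J) is a disjoint union of increasing chains and W_J moves points only along their
--     chains, so two elements of a coset that increase along ind(J) agree (strong induction).
--  6. Such an element exists: undo inverted valleys by transpositions from W_J; the potential
--     Σₓ x · w(x) rises at each step and is at most n³.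
-- The theorem lemma16p1 at the end assembles these facts.

open import Defs
open import Data.Bool as Bool using (Bool; true; false; if_then_else_; T)
open import Data.Bool.Properties using (⇔→≡)
open import Data.Empty using (⊥-elim)
open import Data.Fin as F using (Fin; toℕ; fromℕ<; _≟_; punchIn)
open import Data.Fin.Induction using (<-wellFounded)
open import Data.Fin.Permutation using (Permutation′; _⟨$⟩ʳ_; _⟨$⟩ˡ_; inverseˡ; inverseʳ; permutation)
import Data.Fin.Properties as FP
open import Data.Integer as ℤ using (ℤ; 0ℤ; 1ℤ)
import Data.Integer.Properties as ℤP
import Data.Integer.Tactic.RingSolver as ℤ-Solver
open import Data.List using (List; []; _∷_; take; length; tabulate)
import Data.List.Properties as LP
open import Data.List.Membership.Propositional using (_∈_)
import Data.List.Membership.DecPropositional as DecMembership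
open import Data.List.Relation.Unary.All using (All; []; _∷_)
open import Data.List.Relation.Unary.Any using (here; there)
open import Data.Maybe using (Maybe; just; nothing)
import Data.Maybe.Properties as MP
open import Data.Nat as ℕ using (ℕ; zero; suc; z≤n; s≤s; _+_; _∸_; _*_; _≤_; _<_; _<ᵇ_)
import Data.Nat.Properties as NP
import Data.Nat.Tactic.RingSolver as ℕ-Solver
open import Data.Product using (Σ; ∃; _×_; _,_; proj₁; proj₂)
import Data.Product.Properties as ProductP
open import Data.Sum as Sum using (_⊎_; inj₁; inj₂)
open import Data.Vec.Functional using (updateAt)
import Data.Vec.Functional.Properties as VecP
open import Function using (_∘_; flip; const)
open import Function.Bundles using (mk⇔)
import Induction.WellFounded as WF
open import Level using (0ℓ)
open import Relation.Binary using (Rel)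
open import Relation.Binary.Construct.Closure.ReflexiveTransitive using (Star; ε; _◅_; _◅◅_; reverse)
open import Relation.Binary.Definitions using (tri<; tri≈; tri>)
open import Relation.Binary.PropositionalEquality
open import Relation.Nullary using (¬_; Dec; yes; no; does; contradiction; _×-dec_)
open import Relation.Nullary.Decidable using (map′; dec-true)
open import Relation.Unary using (Pred; Decidable)
open import Algebra.Properties.CommutativeMonoid.Sum NP.+-0-commutativeMonoid using (sum; sum-remove; sum-cong-≗)

-- Part 1. The root order on positive roots is interval containment:
-- e_i - e_j ≤ e_k - e_l  iff  k ≤ i < j ≤ l  (written with 0-based indices).

≤⇒<⊎≡ : ∀ {n} {a b : Fin n} → toℕ a ≤ toℕ b → toℕ a < toℕ b ⊎ a ≡ b
≤⇒<⊎≡ a≤b = Sum.map₂ FP.toℕ-injective (NP.m≤n⇒m<n∨m≡n a≤b)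

-- Nested roots are comparable: if k ≤ i < j ≤ l then
-- (e_k - e_l) - (e_i - e_j) = (e_k - e_i) + (e_j - e_l), a summand with equal indices being omitted.
rootLe-nested : ∀ {n} {i j k l : Fin n} → toℕ k ≤ toℕ i → toℕ j ≤ toℕ l → RootLe (i , j) (k , l)
rootLe-nested {i = i} {j} {k} {l} k≤i j≤l with ≤⇒<⊎≡ k≤i | ≤⇒<⊎≡ j≤l
... | inj₁ k<i  | inj₁ j<l  = (k , i) ∷ (j , l) ∷ [] , k<i ∷ j<l ∷ [] , λ x → both (δ k x) (δ j x) (δ i x) (δ l x)
  where both : ∀ a b c d → (a ℤ.- d) ℤ.- (c ℤ.- b) ≡ (a ℤ.- c) ℤ.+ ((b ℤ.- d) ℤ.+ 0ℤ)
        both = ℤ-Solver.solve-∀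
... | inj₂ refl | inj₁ j<l  = (j , l) ∷ [] , j<l ∷ [] , λ x → right (δ k x) (δ j x) (δ l x)
  where right : ∀ a b d → (a ℤ.- d) ℤ.- (a ℤ.- b) ≡ (b ℤ.- d) ℤ.+ 0ℤ
        right = ℤ-Solver.solve-∀
... | inj₁ k<i  | inj₂ refl = (k , i) ∷ [] , k<i ∷ [] , λ x → left (δ k x) (δ i x) (δ j x)
  where left : ∀ a c d → (a ℤ.- d) ℤ.- (c ℤ.- d) ≡ (a ℤ.- c) ℤ.+ 0ℤ
        left = ℤ-Solver.solve-∀
... | inj₂ refl | inj₂ refl = [] , [] , λ x → ℤP.+-inverseʳ (root k j x)

prefixSum : ∀ {n} → (Fin n → ℤ) → ℕ → ℤ
prefixSum {zero}  v t       = 0ℤ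
prefixSum {suc n} v zero    = 0ℤ
prefixSum {suc n} v (suc t) = v F.zero ℤ.+ prefixSum (v ∘ F.suc) t

prefixSum-cong : ∀ {n} {u v : Fin n → ℤ} → (∀ x → u x ≡ v x) → ∀ t → prefixSum u t ≡ prefixSum v t
prefixSum-cong {zero}  eq t       = refl
prefixSum-cong {suc n} eq zero    = refl
prefixSum-cong {suc n} eq (suc t) = cong₂ ℤ._+_ (eq F.zero) (prefixSum-cong (eq ∘ F.suc) t)

prefixSum-zero : ∀ {n} t → prefixSum {n} (λ _ → 0ℤ) t ≡ 0ℤ
prefixSum-zero {zero}  t       = refl
prefixSum-zero {suc n} zero    = refl
prefixSum-zero {suc n} (suc t) = trans (ℤP.+-identityˡ _) (prefixSum-zero {n} t)

prefixSum-+ : ∀ {n} (u v : Fin n → ℤ) t →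
  prefixSum (λ x → u x ℤ.+ v x) t ≡ prefixSum u t ℤ.+ prefixSum v t
prefixSum-+ {zero}  u v t       = refl
prefixSum-+ {suc n} u v zero    = refl
prefixSum-+ {suc n} u v (suc t) =
  trans (cong (ℤ._+_ (u F.zero ℤ.+ v F.zero)) (prefixSum-+ (u ∘ F.suc) (v ∘ F.suc) t))
        (interchange (u F.zero) (v F.zero) _ _)
  where interchange : ∀ a b c d → (a ℤ.+ b) ℤ.+ (c ℤ.+ d) ≡ (a ℤ.+ c) ℤ.+ (b ℤ.+ d)
        interchange = ℤ-Solver.solve-∀

prefixSum-- : ∀ {n} (u v : Fin n → ℤ) t →
  prefixSum (λ x → u x ℤ.- v x) t ≡ prefixSum u t ℤ.- prefixSum v t
prefixSum-- {zero}  u v t       = refl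
prefixSum-- {suc n} u v zero    = refl
prefixSum-- {suc n} u v (suc t) =
  trans (cong (ℤ._+_ (u F.zero ℤ.- v F.zero)) (prefixSum-- (u ∘ F.suc) (v ∘ F.suc) t))
        (interchange (u F.zero) (v F.zero) _ _)
  where interchange : ∀ a b c d → (a ℤ.- b) ℤ.+ (c ℤ.- d) ≡ (a ℤ.+ c) ℤ.- (b ℤ.+ d)
        interchange = ℤ-Solver.solve-∀

-- [a < t] as an integer; it is the t-th prefix sum of the unit vector e_a.
below : ∀ {n} → Fin n → ℕ → ℤ
below a t = if toℕ a <ᵇ t then 1ℤ else 0ℤ

below-true : ∀ {n} {a : Fin n} {t} → toℕ a < t → below a t ≡ 1ℤ
below-true {a = a} {t} a<t with toℕ a <ᵇ t | NP.<⇒<ᵇ a<t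
... | true | _ = refl

below-false : ∀ {n} {a : Fin n} {t} → t ≤ toℕ a → below a t ≡ 0ℤ
below-false {a = a} {t} t≤a with toℕ a <ᵇ t in eq
... | false = refl
... | true  = contradiction (NP.<ᵇ⇒< (toℕ a) t (subst T (sym eq) _)) (NP.≤⇒≯ t≤a)

δ-suc : ∀ {n} (a x : Fin n) → δ (F.suc a) (F.suc x) ≡ δ a x
δ-suc a x with x ≟ a
... | yes _ = refl
... | no _  = refl

prefixSum-δ : ∀ {n} (a : Fin n) t → prefixSum (δ a) t ≡ below a t
prefixSum-δ         F.zero    zero    = refl
prefixSum-δ {suc n} F.zero    (suc t) = cong (ℤ._+_ 1ℤ) (prefixSum-zero {n} t)
prefixSum-δ         (F.suc a) zero    = refl
prefixSum-δ         (F.suc a) (suc t) =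
  trans (ℤP.+-identityˡ _) (trans (prefixSum-cong (δ-suc a) t) (prefixSum-δ a t))

prefixSum-root : ∀ {n} (a b : Fin n) t → prefixSum (root a b) t ≡ below a t ℤ.- below b t
prefixSum-root a b t = trans (prefixSum-- (δ a) (δ b) t) (cong₂ ℤ._-_ (prefixSum-δ a t) (prefixSum-δ b t))

window-inside : ∀ {n} {a b : Fin n} {t} → toℕ a < t → t ≤ toℕ b → below a t ℤ.- below b t ≡ 1ℤ
window-inside a<t t≤b rewrite below-true a<t | below-false t≤b = refl

window-before : ∀ {n} {a b : Fin n} {t} → toℕ a < toℕ b → t ≤ toℕ a → below a t ℤ.- below b t ≡ 0ℤ
window-before a<b t≤a rewrite below-false t≤a | below-false (NP.≤-trans t≤a (NP.<⇒≤ a<b)) = refl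

window-after : ∀ {n} {a b : Fin n} {t} → toℕ a < toℕ b → toℕ b < t → below a t ℤ.- below b t ≡ 0ℤ
window-after a<b b<t rewrite below-true (NP.<-trans a<b b<t) | below-true b<t = refl

prefixSum-positive : ∀ {n} (ps : List (Fin n × Fin n)) → All IsPos ps → ∀ t →
  0ℤ ℤ.≤ prefixSum (sumRoots ps) t
prefixSum-positive {n} [] [] t = ℤP.≤-reflexive (sym (prefixSum-zero {n} t))
prefixSum-positive ((a , b) ∷ ps) (a<b ∷ pos) t =
  subst (0ℤ ℤ.≤_) (sym (prefixSum-+ (root a b) (sumRoots ps) t))
        (ℤP.+-mono-≤ (subst (0ℤ ℤ.≤_) (sym (prefixSum-root a b t)) window) (prefixSum-positive ps pos t))
  where
  window : 0ℤ ℤ.≤ below a t ℤ.- below b t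
  window with t ℕ.≤? toℕ a | toℕ b ℕ.<? t
  ... | yes t≤a | _       = ℤP.≤-reflexive (sym (window-before a<b t≤a))
  ... | no _    | yes b<t = ℤP.≤-reflexive (sym (window-after a<b b<t))
  ... | no t≰a  | no b≮t  = subst (0ℤ ℤ.≤_) (sym (window-inside (NP.≰⇒> t≰a) (NP.≮⇒≥ b≮t))) (ℤ.+≤+ z≤n)

rootLe-prefixSum : ∀ {n} {i j k l : Fin n} → RootLe (k , l) (i , j) → ∀ t →
  below k t ℤ.- below l t ℤ.≤ below i t ℤ.- below j t
rootLe-prefixSum {i = i} {j} {k} {l} (ps , pos , diff) t =
  ℤP.0≤i-j⇒j≤i (subst (0ℤ ℤ.≤_) sums (prefixSum-positive ps pos t))
  where
  open ≡-Reasoning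
  sums : prefixSum (sumRoots ps) t ≡ (below i t ℤ.- below j t) ℤ.- (below k t ℤ.- below l t)
  sums = begin
    prefixSum (sumRoots ps) t                                ≡⟨ prefixSum-cong (sym ∘ diff) t ⟩
    prefixSum (λ x → root i j x ℤ.- root k l x) t            ≡⟨ prefixSum-- (root i j) (root k l) t ⟩
    prefixSum (root i j) t ℤ.- prefixSum (root k l) t        ≡⟨ cong₂ ℤ._-_ (prefixSum-root i j t) (prefixSum-root k l t) ⟩
    (below i t ℤ.- below j t) ℤ.- (below k t ℤ.- below l t)  ∎

-- The converse of rootLe-nested: e_k - e_l ≤ e_i - e_j forces i ≤ k and l ≤ j.
-- The window of (k , l) is 1 at t = k + 1 and at t = l, so the window of (i , j) must be too.
rootLe⇒nested : ∀ {n} {i j k l : Fin n} → toℕ i < toℕ j → toℕ k < toℕ l →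
  RootLe (k , l) (i , j) → toℕ i ≤ toℕ k × toℕ l ≤ toℕ j
rootLe⇒nested {i = i} {j} {k} {l} i<j k<l le = i≤k , l≤j
  where
  1≰0 : ¬ (1ℤ ℤ.≤ 0ℤ)
  1≰0 (ℤ.+≤+ ())
  outside-impossible : ∀ t → toℕ k < t → t ≤ toℕ l → below i t ℤ.- below j t ≢ 0ℤ
  outside-impossible t k<t t≤l outside = 1≰0 (subst₂ ℤ._≤_ (window-inside k<t t≤l) outside (rootLe-prefixSum le t))
  i≤k : toℕ i ≤ toℕ k
  i≤k with toℕ i ℕ.≤? toℕ k
  ... | yes i≤k = i≤k
  ... | no i≰k  = ⊥-elim (outside-impossible (suc (toℕ k)) NP.≤-refl k<l (window-before i<j (NP.≰⇒> i≰k)))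
  l≤j : toℕ l ≤ toℕ j
  l≤j with toℕ l ℕ.≤? toℕ j
  ... | yes l≤j = l≤j
  ... | no l≰j  = ⊥-elim (outside-impossible (toℕ l) k<l NP.≤-refl (window-after i<j (NP.≰⇒> l≰j)))

-- Part 2. Lattice paths, encoded by the heights of their East steps.

nth-exists : ∀ xs i → i < length xs → Σ ℕ λ x → nth xs i ≡ just x
nth-exists (x ∷ xs) zero    _         = x , refl
nth-exists (x ∷ xs) (suc i) (s≤s i<l) = nth-exists xs i i<l

nth-tabulate : ∀ {n} (f : Fin n → ℕ) (i : Fin n) → nth (tabulate f) (toℕ i) ≡ just (f i)
nth-tabulate f F.zero    = refl
nth-tabulate f (F.suc i) = nth-tabulate (f ∘ F.suc) i

nth-tabulate⁻ : ∀ {n} (f : Fin n → ℕ) i {x} → nth (tabulate f) i ≡ just x →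
  Σ (Fin n) λ a → toℕ a ≡ i × f a ≡ x
nth-tabulate⁻ {suc n} f zero    refl = F.zero , refl , refl
nth-tabulate⁻ {suc n} f (suc i) eq with nth-tabulate⁻ (f ∘ F.suc) i eq
... | a , refl , fa≡x = F.suc a , refl , fa≡x

tabulate-unique : ∀ {n} (f : Fin n → ℕ) xs → length xs ≡ n →
  (∀ i → nth xs (toℕ i) ≡ just (f i)) → xs ≡ tabulate f
tabulate-unique {zero}  f []       _   _  = refl
tabulate-unique {suc n} f (x ∷ xs) len at =
  cong₂ _∷_ (MP.just-injective (at F.zero)) (tabulate-unique (f ∘ F.suc) xs (NP.suc-injective len) (at ∘ F.suc))

heights-≥ : ∀ D m i {h} → nth (heights D m) i ≡ just h → m ≤ h
heights-≥ (N ∷ D) m i       eq   = NP.<⇒≤ (heights-≥ D (suc m) i eq)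
heights-≥ (E ∷ D) m zero    refl = NP.≤-refl
heights-≥ (E ∷ D) m (suc i) eq   = heights-≥ D m i eq

heights-≤ : ∀ D m i {h} → nth (heights D m) i ≡ just h → h ≤ m + countN D
heights-≤ (N ∷ D) m i {h} eq = subst (h ≤_) (sym (NP.+-suc m (countN D))) (heights-≤ D (suc m) i eq)
heights-≤ (E ∷ D) m zero    refl = NP.m≤m+n m _
heights-≤ (E ∷ D) m (suc i) eq   = heights-≤ D m i eq

heights-mono : ∀ D m {i i′ h h′} → i ≤ i′ →
  nth (heights D m) i ≡ just h → nth (heights D m) i′ ≡ just h′ → h ≤ h′
heights-mono (N ∷ D) m i≤i′         eq   eq′  = heights-mono D (suc m) i≤i′ eq eq′
heights-mono (E ∷ D) m {zero} {zero}   _  refl refl = NP.≤-refl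
heights-mono (E ∷ D) m {zero} {suc i′} _  refl eq′  = heights-≥ D m i′ eq′
heights-mono (E ∷ D) m {suc i} {suc i′} (s≤s i≤i′) eq eq′ = heights-mono D m i≤i′ eq eq′

length-heights : ∀ D m → length (heights D m) ≡ countE D
length-heights []      m = refl
length-heights (N ∷ D) m = length-heights D (suc m)
length-heights (E ∷ D) m = cong suc (length-heights D m)

no-step-at-start : ∀ D m {hs} → heights D (suc m) ≢ m ∷ hs
no-step-at-start D m eq = NP.<-irrefl refl (heights-≥ D (suc m) 0 (cong (λ hs → nth hs 0) eq))

path-determined : ∀ D D′ m → heights D m ≡ heights D′ m → countN D ≡ countN D′ → D ≡ D′
path-determined []      []       m _  _ = refl
path-determined []      (N ∷ D′) m _  ()
path-determined []      (E ∷ D′) m () _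
path-determined (N ∷ D) []       m _  ()
path-determined (E ∷ D) []       m () _
path-determined (N ∷ D) (N ∷ D′) m hs ns = cong (N ∷_) (path-determined D D′ (suc m) hs (NP.suc-injective ns))
path-determined (E ∷ D) (E ∷ D′) m hs ns = cong (E ∷_) (path-determined D D′ m (LP.∷-injectiveʳ hs) ns)
path-determined (N ∷ D) (E ∷ D′) m hs _  = ⊥-elim (no-step-at-start D m hs)
path-determined (E ∷ D) (N ∷ D′) m hs _  = ⊥-elim (no-step-at-start D′ m (sym hs))

PrefixesAbove : ℕ → ℕ → List Step → Set
PrefixesAbove e m D = ∀ k → e + countE (take k D) ≤ m + countN (take k D)

EastStepsAbove : ℕ → ℕ → List Step → Set
EastStepsAbove e m D = ∀ i {h} → nth (heights D m) i ≡ just h → e + i < h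

prefixes⇒eastSteps : ∀ D e m → PrefixesAbove e m D → EastStepsAbove e m D
prefixes⇒eastSteps (N ∷ D) e m above i eq =
  prefixes⇒eastSteps D e (suc m) (λ k → subst (e + countE (take k D) ≤_) (NP.+-suc m _) (above (suc k))) i eq
prefixes⇒eastSteps (E ∷ D) e m above zero refl =
  subst₂ _≤_ (NP.+-suc e 0) (NP.+-identityʳ m) (above 1)
prefixes⇒eastSteps (E ∷ D) e m above (suc i) {h} eq =
  subst (_< h) (sym (NP.+-suc e i))
    (prefixes⇒eastSteps D (suc e) m (λ k → subst (_≤ m + countN (take k D)) (NP.+-suc e _) (above (suc k))) i eq)

eastSteps⇒prefixes : ∀ D e m → e ≤ m → EastStepsAbove e m D → PrefixesAbove e m D
eastSteps⇒prefixes D       e m e≤m above zero    = subst₂ _≤_ (sym (NP.+-identityʳ e)) (sym (NP.+-identityʳ m)) e≤m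
eastSteps⇒prefixes []      e m e≤m above (suc k) = subst₂ _≤_ (sym (NP.+-identityʳ e)) (sym (NP.+-identityʳ m)) e≤m
eastSteps⇒prefixes (N ∷ D) e m e≤m above (suc k) =
  subst (e + countE (take k D) ≤_) (sym (NP.+-suc m _))
    (eastSteps⇒prefixes D e (suc m) (NP.m≤n⇒m≤1+n e≤m) above k)
eastSteps⇒prefixes (E ∷ D) e m e≤m above (suc k) =
  subst (_≤ m + countN (take k D)) (sym (NP.+-suc e _))
    (eastSteps⇒prefixes D (suc e) m (subst (_≤ m) (cong suc (NP.+-identityʳ e)) (above zero refl))
      (λ i {h} eq → subst (_< h) (NP.+-suc e i) (above (suc i) eq)) k)

-- Valleys are the corners of the height sequence: an East step at height b
-- whose successor East step (if any) is higher.

Corner : List ℕ → ℕ → ℕ → Set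
Corner hs i b = nth hs i ≡ just b × (∀ {b′} → nth hs (suc i) ≡ just b′ → b < b′)

valley⇒corner : ∀ D e m {a b} → (a , b) ∈ valleys D e m →
  Σ ℕ λ i → a ≡ e + i × Corner (heights D m) i b
valley⇒corner (N ∷ D)     e m v = valley⇒corner D e (suc m) v
valley⇒corner (E ∷ E ∷ D) e m v with valley⇒corner (E ∷ D) (suc e) m v
... | i , refl , corner = suc i , sym (NP.+-suc e i) , corner
valley⇒corner (E ∷ N ∷ D) e m (here refl) = 0 , sym (NP.+-identityʳ e) , refl , heights-≥ D (suc m) 0
valley⇒corner (E ∷ N ∷ D) e m (there v) with valley⇒corner (N ∷ D) (suc e) m v
... | i , refl , corner = suc i , sym (NP.+-suc e i) , corner

corner⇒valley : ∀ D e m i {b} → Corner (heights D m) i b → b < m + countN D → (e + i , b) ∈ valleys D e m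
corner⇒valley (N ∷ D) e m i {b} corner b<top =
  corner⇒valley D e (suc m) i corner (subst (b <_) (NP.+-suc m (countN D)) b<top)
corner⇒valley (E ∷ []) e m zero (refl , _) b<top = ⊥-elim (NP.<-irrefl (sym (NP.+-identityʳ m)) b<top)
corner⇒valley (E ∷ E ∷ D) e m zero (refl , higher) _ = ⊥-elim (NP.<-irrefl refl (higher refl))
corner⇒valley (E ∷ E ∷ D) e m (suc i) {b} corner b<top =
  subst (λ a → (a , b) ∈ valleys (E ∷ E ∷ D) e m) (sym (NP.+-suc e i)) (corner⇒valley (E ∷ D) (suc e) m i corner b<top)
corner⇒valley (E ∷ N ∷ D) e m zero (refl , _) _ = here (cong (_, m) (NP.+-identityʳ e))
corner⇒valley (E ∷ N ∷ D) e m (suc i) {b} corner b<top =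
  there (subst (λ a → (a , b) ∈ valleys (N ∷ D) (suc e) m) (sym (NP.+-suc e i))
    (corner⇒valley (N ∷ D) (suc e) m i corner b<top))

rise : ℕ → List Step → List Step
rise zero    D = D
rise (suc k) D = N ∷ rise k D

heights-rise : ∀ k D m → heights (rise k D) m ≡ heights D (k + m)
heights-rise zero    D m = refl
heights-rise (suc k) D m = trans (heights-rise k D (suc m)) (cong (heights D) (NP.+-suc k m))

countN-rise : ∀ k D → countN (rise k D) ≡ k + countN D
countN-rise zero    D = refl
countN-rise (suc k) D = cong suc (countN-rise k D)

countE-rise : ∀ k D → countE (rise k D) ≡ countE D
countE-rise zero    D = refl
countE-rise (suc k) D = countE-rise k D

record Staircase {k} (m : ℕ) (f : Fin k → ℕ) (top : ℕ) : Set where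
  field
    bottom≤top : m ≤ top
    bottom≤    : ∀ i → m ≤ f i
    ≤top       : ∀ i → f i ≤ top
    monotone   : ∀ i j → toℕ i ≤ toℕ j → f i ≤ f j

staircase-tail : ∀ {k m top} {f : Fin (suc k) → ℕ} → Staircase m f top → Staircase (f F.zero) (f ∘ F.suc) top
staircase-tail s = record
  { bottom≤top = ≤top F.zero
  ; bottom≤    = λ i → monotone F.zero (F.suc i) z≤n
  ; ≤top       = ≤top ∘ F.suc
  ; monotone   = λ i j i≤j → monotone (F.suc i) (F.suc j) (s≤s i≤j)
  }
  where open Staircase s

staircase : ∀ {k} → ℕ → (Fin k → ℕ) → ℕ → List Step
staircase {zero}  m f top = rise (top ∸ m) []
staircase {suc k} m f top = rise (f F.zero ∸ m) (E ∷ staircase (f F.zero) (f ∘ F.suc) top)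

staircase-heights : ∀ {k m top} {f : Fin k → ℕ} → Staircase m f top → heights (staircase m f top) m ≡ tabulate f
staircase-heights {zero}  {m} {top}     s = heights-rise (top ∸ m) [] m
staircase-heights {suc k} {m} {top} {f} s = begin
  heights (rise (f F.zero ∸ m) rest) m       ≡⟨ heights-rise (f F.zero ∸ m) rest m ⟩
  heights rest (f F.zero ∸ m + m)            ≡⟨ cong (heights rest) (NP.m∸n+n≡m (Staircase.bottom≤ s F.zero)) ⟩
  f F.zero ∷ heights (staircase (f F.zero) (f ∘ F.suc) top) (f F.zero)
                                             ≡⟨ cong (f F.zero ∷_) (staircase-heights (staircase-tail s)) ⟩
  tabulate f                                 ∎
  where
  open ≡-Reasoning
  rest = E ∷ staircase (f F.zero) (f ∘ F.suc) top

staircase-countN : ∀ {k m top} {f : Fin k → ℕ} → Staircase m f top → m + countN (staircase m f top) ≡ top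
staircase-countN {zero}  {m} {top}     s =
  trans (cong (m +_) (trans (countN-rise (top ∸ m) []) (NP.+-identityʳ _))) (NP.m+[n∸m]≡n (Staircase.bottom≤top s))
staircase-countN {suc k} {m} {top} {f} s = begin
  m + countN (rise (f F.zero ∸ m) rest)       ≡⟨ cong (m +_) (countN-rise (f F.zero ∸ m) rest) ⟩
  m + (f F.zero ∸ m + countN rest)            ≡⟨ sym (NP.+-assoc m _ _) ⟩
  m + (f F.zero ∸ m) + countN rest            ≡⟨ cong (_+ countN rest) (NP.m+[n∸m]≡n (Staircase.bottom≤ s F.zero)) ⟩
  f F.zero + countN rest                      ≡⟨ staircase-countN (staircase-tail s) ⟩
  top                                         ∎
  where
  open ≡-Reasoning
  rest = E ∷ staircase (f F.zero) (f ∘ F.suc) top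

staircase-countE : ∀ {k} m (f : Fin k → ℕ) top → countE (staircase m f top) ≡ k
staircase-countE {zero}  m f top = countE-rise (top ∸ m) []
staircase-countE {suc k} m f top = trans (countE-rise (f F.zero ∸ m) _) (cong suc (staircase-countE (f F.zero) (f ∘ F.suc) top))

module _ {n D} (dyck : IsDyck n D) where

  dyck-length : length (heights D 0) ≡ n
  dyck-length = trans (length-heights D 0) (proj₁ (proj₂ dyck))

  dyck-height : ∀ i → i < n → Σ ℕ λ h → nth (heights D 0) i ≡ just h
  dyck-height i i<n = nth-exists (heights D 0) i (subst (i <_) (sym dyck-length) i<n)

  dyck-above : ∀ i {h} → nth (heights D 0) i ≡ just h → i < h
  dyck-above = prefixes⇒eastSteps D 0 0 (proj₂ (proj₂ dyck))

  dyck-≤ : ∀ i {h} → nth (heights D 0) i ≡ just h → h ≤ n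
  dyck-≤ i eq = subst (_ ≤_) (proj₁ dyck) (heights-≤ D 0 i eq)

-- Part 3. The Dyck path D(J) of an order filter J exists and is unique.

fin : ∀ {n} i → i < n → Σ (Fin n) λ a → toℕ a ≡ i
fin i i<n = fromℕ< i<n , FP.toℕ-fromℕ< i<n

firstIndex : ∀ {n} {P : Pred (Fin n) 0ℓ} → Decidable P → ℕ
firstIndex {zero}  P? = 0
firstIndex {suc n} P? with P? F.zero
... | yes _ = 0
... | no _  = suc (firstIndex (P? ∘ F.suc))

firstIndex-≤ : ∀ {n} {P : Pred (Fin n) 0ℓ} (P? : Decidable P) → firstIndex P? ≤ n
firstIndex-≤ {zero}  P? = z≤n
firstIndex-≤ {suc n} P? with P? F.zero
... | yes _ = z≤n
... | no _  = s≤s (firstIndex-≤ (P? ∘ F.suc))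

firstIndex-least : ∀ {n} {P : Pred (Fin n) 0ℓ} (P? : Decidable P) {j} → P j → firstIndex P? ≤ toℕ j
firstIndex-least {suc n} P? {j} pj with P? F.zero | j
... | yes _  | _       = z≤n
... | no ¬p0 | F.zero  = ⊥-elim (¬p0 pj)
... | no _   | F.suc j = s≤s (firstIndex-least (P? ∘ F.suc) pj)

firstIndex-hit : ∀ {n} {P : Pred (Fin n) 0ℓ} (P? : Decidable P) {j} → toℕ j ≡ firstIndex P? → P j
firstIndex-hit {suc n} P? {j} eq with P? F.zero | j
... | yes p0 | F.zero  = p0
... | no _   | F.suc j = firstIndex-hit (P? ∘ F.suc) (NP.suc-injective eq)

inJ? : ∀ {n} (J : Sub n) (i : Fin n) → Decidable (InJ J i)
inJ? J i j = (i F.<? j) ×-dec (J i j Bool.≟ true)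

rowStart : ∀ {n} → Sub n → Fin n → ℕ
rowStart J i = firstIndex (inJ? J i)

module _ {n} (J : Sub n) where

  rowStart-≤ : ∀ i → rowStart J i ≤ n
  rowStart-≤ i = firstIndex-≤ (inJ? J i)

  rowStart-least : ∀ {i j} → InJ J i j → rowStart J i ≤ toℕ j
  rowStart-least {i} = firstIndex-least (inJ? J i)

  rowStart-hit : ∀ {i j} → toℕ j ≡ rowStart J i → InJ J i j
  rowStart-hit {i} = firstIndex-hit (inJ? J i)

  rowStart-above : ∀ i → toℕ i < rowStart J i
  rowStart-above i with toℕ i ℕ.<? rowStart J i
  ... | yes i<r = i<r
  ... | no i≮r with fin (rowStart J i) (NP.≤-<-trans (NP.≮⇒≥ i≮r) (FP.toℕ<n i))
  ...   | r , r≡ = ⊥-elim (i≮r (subst (toℕ i <_) r≡ (proj₁ (rowStart-hit r≡))))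

module _ {n} {J : Sub n} (filter : IsFilter J) where

  filter-widen : ∀ {i j k l} → InJ J i j → toℕ k ≤ toℕ i → toℕ j ≤ toℕ l → InJ J k l
  filter-widen {i} {j} {k} {l} inJ k≤i j≤l =
    filter i j k l inJ (NP.≤-<-trans k≤i (NP.<-≤-trans (proj₁ inJ) j≤l)) (rootLe-nested k≤i j≤l)

  filter-row : ∀ {i j} → i F.< j → rowStart J i ≤ toℕ j → InJ J i j
  filter-row {i} {j} i<j r≤j with fin (rowStart J i) (NP.≤-<-trans r≤j (FP.toℕ<n j))
  ... | r , r≡ = filter-widen (rowStart-hit J r≡) NP.≤-refl (subst (_≤ toℕ j) (sym r≡) r≤j)

  rowStart-monotone : ∀ i i′ → toℕ i ≤ toℕ i′ → rowStart J i ≤ rowStart J i′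
  rowStart-monotone i i′ i≤i′ with rowStart J i′ ℕ.<? n
  ... | no r≮n   = NP.≤-trans (rowStart-≤ J i) (NP.≮⇒≥ r≮n)
  ... | yes r<n with fin (rowStart J i′) r<n
  ...   | r , r≡ = subst (rowStart J i ≤_) r≡ (rowStart-least J (filter-widen (rowStart-hit J r≡) i≤i′ NP.≤-refl))

  rowStart-staircase : Staircase 0 (rowStart J) n
  rowStart-staircase = record
    { bottom≤top = z≤n ; bottom≤ = λ _ → z≤n ; ≤top = rowStart-≤ J ; monotone = rowStart-monotone }

box-height : ∀ {n} D {i j : Fin n} {h} → nth (heights D 0) (toℕ i) ≡ just h → BoxAbove D i j → h ≤ toℕ j
box-height D eq (h′ , eq′ , h′≤j) = subst (_≤ _) (MP.just-injective (trans (sym eq′) eq)) h′≤j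

module _ {n} {J : Sub n} {D} (dj : IsDJ J D) where

  DJ-member⇒ : ∀ {i j h} → nth (heights D 0) (toℕ i) ≡ just h → InJ J i j → h ≤ toℕ j
  DJ-member⇒ {i} {j} eq inJ = box-height D eq (proj₂ (proj₂ dj i j (proj₁ inJ)) inJ)

  DJ-member⇐ : ∀ {i j h} → nth (heights D 0) (toℕ i) ≡ just h → i F.< j → h ≤ toℕ j → InJ J i j
  DJ-member⇐ {i} {j} {h} eq i<j h≤j = proj₁ (proj₂ dj i j i<j) (h , eq , h≤j)

  DJ-heights : ∀ i → nth (heights D 0) (toℕ i) ≡ just (rowStart J i)
  DJ-heights i with dyck-height (proj₁ dj) (toℕ i) (FP.toℕ<n i)
  ... | h , eq = subst (λ x → nth (heights D 0) (toℕ i) ≡ just x) (NP.≤-antisym h≤r r≤h) eq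
    where
    r≤h : rowStart J i ≤ h
    r≤h with h ℕ.<? n
    ... | no h≮n  = NP.≤-trans (rowStart-≤ J i) (NP.≮⇒≥ h≮n)
    ... | yes h<n with fin h h<n
    ...   | b , refl = rowStart-least J (DJ-member⇐ eq (dyck-above (proj₁ dj) (toℕ i) eq) NP.≤-refl)
    h≤r : h ≤ rowStart J i
    h≤r with rowStart J i ℕ.<? n
    ... | no r≮n  = NP.≤-trans (dyck-≤ (proj₁ dj) (toℕ i) eq) (NP.≮⇒≥ r≮n)
    ... | yes r<n with fin (rowStart J i) r<n
    ...   | c , c≡r = subst (h ≤_) c≡r (DJ-member⇒ eq (rowStart-hit J c≡r))

  DJ-heights-tabulate : heights D 0 ≡ tabulate (rowStart J)
  DJ-heights-tabulate = tabulate-unique (rowStart J) (heights D 0) (dyck-length (proj₁ dj)) DJ-heights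

DJ-unique : ∀ {n} (J : Sub n) (D D′ : List Step) → IsDJ J D → IsDJ J D′ → D ≡ D′
DJ-unique J D D′ dj dj′ = path-determined D D′ 0
  (trans (DJ-heights-tabulate dj) (sym (DJ-heights-tabulate dj′)))
  (trans (proj₁ (proj₁ dj)) (sym (proj₁ (proj₁ dj′))))

-- D(J) exists: it is the staircase whose i-th East step runs at height rowStart J i.
DJ-exists : ∀ {n} (J : Sub n) → IsFilter J → Σ (List Step) (IsDJ J)
DJ-exists {n} J filter = P , (countN-P , countE-P , prefixes) , boxes
  where
  P = staircase 0 (rowStart J) n
  heights-P : heights P 0 ≡ tabulate (rowStart J)
  heights-P = staircase-heights (rowStart-staircase filter)
  countN-P : countN P ≡ n
  countN-P = staircase-countN (rowStart-staircase filter)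
  countE-P : countE P ≡ n
  countE-P = staircase-countE 0 (rowStart J) n
  height-P : ∀ i → nth (heights P 0) (toℕ i) ≡ just (rowStart J i)
  height-P i = trans (cong (λ hs → nth hs (toℕ i)) heights-P) (nth-tabulate (rowStart J) i)
  above : ∀ i {h} → nth (heights P 0) i ≡ just h → i < h
  above i eq with nth-tabulate⁻ (rowStart J) i (trans (cong (λ hs → nth hs i) (sym heights-P)) eq)
  ... | a , refl , refl = rowStart-above J a
  prefixes : ∀ k → countE (take k P) ≤ countN (take k P)
  prefixes = eastSteps⇒prefixes P 0 0 z≤n above
  boxes : ∀ i j → i F.< j → (BoxAbove P i j → InJ J i j) × (InJ J i j → BoxAbove P i j)
  boxes i j i<j = (λ box → filter-row filter i<j (box-height P (height-P i) box))
                , (λ inJ → rowStart J i , height-P i , rowStart-least J inJ)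

-- Part 4. Valleys of D(J) versus ind(J), and the filter of a Dyck path.

-- The valleys of D(J) are exactly the minimal elements ind(J): both are the corners
-- of the height sequence of D(J).
module _ {n} {J : Sub n} {D} (dj : IsDJ J D) where
  private
    dyck = proj₁ dj

  -- A corner (i , j) gives e_i - e_j ∈ J.  If e_k - e_l ∈ J lies below it then i ≤ k and l ≤ j,
  -- so j ≤ h_k ≤ l ≤ j; and i < k would give h_{i+1} ≤ h_k ≤ j, contradicting the corner.
  corner⇒ind : ∀ (i j : Fin n) → Corner (heights D 0) (toℕ i) (toℕ j) → InInd J i j
  corner⇒ind i j (eq , higher) = inJ , minimal
    where
    i<j = dyck-above dyck (toℕ i) eq
    inJ = DJ-member⇐ dj eq i<j NP.≤-refl
    minimal : ∀ k l → InJ J k l → RootLe (k , l) (i , j) → k ≡ i × l ≡ j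
    minimal k l kl le with rootLe⇒nested i<j (proj₁ kl) le | dyck-height dyck (toℕ k) (FP.toℕ<n k)
    ... | i≤k , l≤j | hₖ , eₖ = k≡i , FP.toℕ-injective (NP.≤-antisym l≤j (NP.≤-trans j≤hₖ hₖ≤l))
      where
      hₖ≤l = DJ-member⇒ dj eₖ kl
      j≤hₖ = heights-mono D 0 i≤k eq eₖ
      k≡i : k ≡ i
      k≡i with ≤⇒<⊎≡ i≤k
      ... | inj₂ i≡k = sym i≡k
      ... | inj₁ i<k with dyck-height dyck (suc (toℕ i)) (NP.≤-<-trans i<k (FP.toℕ<n k))
      ...   | h′ , e′ = ⊥-elim (NP.<-irrefl refl
              (NP.<-≤-trans (higher e′) (NP.≤-trans (heights-mono D 0 i<k e′ eₖ) (NP.≤-trans hₖ≤l l≤j))))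

  -- Conversely let e_i - e_j ∈ ind(J), so h_i ≤ j.  If h_i < j then e_i - e_{h_i} ∈ J lies strictly
  -- below e_i - e_j; if the next height h′ were ≤ j then so would e_{i+1} - e_j ∈ J.
  ind⇒corner : ∀ {i j} → InInd J i j → Corner (heights D 0) (toℕ i) (toℕ j)
  ind⇒corner {i} {j} (inJ , minimal) with dyck-height dyck (toℕ i) (FP.toℕ<n i)
  ... | h , eq = subst (λ x → nth (heights D 0) (toℕ i) ≡ just x) h≡j eq , λ e′ → NP.≰⇒> (next-not-low e′)
    where
    h≡j : h ≡ toℕ j
    h≡j with NP.m≤n⇒m<n∨m≡n (DJ-member⇒ dj eq inJ)
    ... | inj₂ h≡j = h≡j
    ... | inj₁ h<j with fin h (NP.<-trans h<j (FP.toℕ<n j))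
    ...   | b , refl = ⊥-elim (NP.<-irrefl (cong toℕ (proj₂ (minimal i b inJb (rootLe-nested NP.≤-refl (NP.<⇒≤ h<j))))) h<j)
      where inJb = DJ-member⇐ dj eq (dyck-above dyck (toℕ i) eq) NP.≤-refl
    next-not-low : ∀ {h′} → nth (heights D 0) (suc (toℕ i)) ≡ just h′ → ¬ h′ ≤ toℕ j
    next-not-low {h′} e′ h′≤j
      with fin (suc (toℕ i)) (NP.<-≤-trans (dyck-above dyck _ e′) (NP.≤-trans h′≤j (NP.<⇒≤ (FP.toℕ<n j))))
    ... | c , c≡ = NP.1+n≢n (trans (sym c≡) (cong toℕ c≡i))
      where
      eᶜ : nth (heights D 0) (toℕ c) ≡ just h′
      eᶜ = subst (λ x → nth (heights D 0) x ≡ just h′) (sym c≡) e′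
      inJc = DJ-member⇐ dj eᶜ (NP.<-≤-trans (dyck-above dyck (toℕ c) eᶜ) h′≤j) h′≤j
      c≡i = proj₁ (minimal c j inJc (rootLe-nested (subst (toℕ i ≤_) (sym c≡) (NP.n≤1+n _)) NP.≤-refl))

  valley⇒ind : ∀ (i j : Fin n) → (toℕ i , toℕ j) ∈ valleys D 0 0 → InInd J i j
  valley⇒ind i j v with valley⇒corner D 0 0 v
  ... | _ , refl , corner = corner⇒ind i j corner

  ind⇒valley : ∀ (i j : Fin n) → InInd J i j → (toℕ i , toℕ j) ∈ valleys D 0 0
  ind⇒valley i j ind = corner⇒valley D 0 0 (toℕ i) (ind⇒corner ind) (subst (toℕ j <_) (sym (proj₁ dyck)) (FP.toℕ<n j))

decided : ∀ {A : Set} (a? : Dec A) → does a? ≡ true → A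
decided (yes a) _ = a

boxAt? : (hᵢ : Maybe ℕ) (j : ℕ) → Dec (Σ ℕ λ h → hᵢ ≡ just h × h ≤ j)
boxAt? nothing  j = no λ ()
boxAt? (just h) j = map′ (λ h≤j → h , refl , h≤j) (λ { (_ , refl , h≤j) → h≤j }) (h ℕ.≤? j)

boxesAbove : ∀ {n} → List Step → Sub n
boxesAbove D i j = does (boxAt? (nth (heights D 0) (toℕ i)) (toℕ j))

module _ {n D} (dyck : IsDyck n D) where

  boxesAbove-DJ : IsDJ (boxesAbove D) D
  boxesAbove-DJ = dyck , λ i j i<j →
    (λ box → i<j , dec-true (boxAt? _ (toℕ j)) box) , (λ inJ → decided (boxAt? _ (toℕ j)) (proj₂ inJ))

  -- the boxes above a Dyck path form an order filter: widening (i , j) to (k , l)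
  -- moves the East step down (h_k ≤ h_i) and the box up (j ≤ l)
  boxesAbove-filter : IsFilter (boxesAbove D)
  boxesAbove-filter i j k l inJ k<l le with rootLe⇒nested k<l (proj₁ inJ) le
                                          | dyck-height dyck (toℕ i) (FP.toℕ<n i)
                                          | dyck-height dyck (toℕ k) (FP.toℕ<n k)
  ... | k≤i , j≤l | hᵢ , eᵢ | hₖ , eₖ = DJ-member⇐ boxesAbove-DJ eₖ k<l
        (NP.≤-trans (heights-mono D 0 k≤i eₖ eᵢ) (NP.≤-trans (DJ-member⇒ boxesAbove-DJ eᵢ inJ) j≤l))

-- Part 5. The parabolic subgroup W_J, and uniqueness of the representative w′.

Functional : ∀ {A : Set} → Rel A 0ℓ → Set
Functional R = ∀ {a b c} → R a b → R a c → b ≡ c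

Comparable : ∀ {A : Set} → Rel A 0ℓ → Rel A 0ℓ
Comparable R x y = Star R x y ⊎ Star R y x

star-fork : ∀ {A : Set} {R : Rel A 0ℓ} → Functional R → ∀ {x y z} → Star R x y → Star R x z → Comparable R y z
star-fork functional ε        xz       = inj₁ xz
star-fork functional (r ◅ ry) ε        = inj₂ (r ◅ ry)
star-fork functional (r ◅ ry) (r′ ◅ rz) with functional r r′
... | refl = star-fork functional ry rz

module _ {A : Set} {R : Rel A 0ℓ} where

  comparable-refl : ∀ {x} → Comparable R x x
  comparable-refl = inj₁ ε

  comparable-sym : ∀ {x y} → Comparable R x y → Comparable R y x
  comparable-sym (inj₁ xy) = inj₂ xy
  comparable-sym (inj₂ yx) = inj₁ yx

  comparable-trans : Functional R → Functional (flip R) →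
    ∀ {x y z} → Comparable R x y → Comparable R y z → Comparable R x z
  comparable-trans succ pred (inj₁ xy) (inj₁ yz) = inj₁ (xy ◅◅ yz)
  comparable-trans succ pred (inj₂ yx) (inj₂ zy) = inj₂ (zy ◅◅ yx)
  comparable-trans succ pred (inj₂ yx) (inj₁ yz) = star-fork succ yx yz
  comparable-trans succ pred (inj₁ xy) (inj₂ zy)
    with star-fork {R = flip R} pred (reverse (λ r → r) xy) (reverse (λ r → r) zy)
  ... | inj₁ xz = inj₂ (reverse (λ r → r) xz)
  ... | inj₂ zx = inj₁ (reverse (λ r → r) zx)

  star-increasing : (f : A → ℕ) → (∀ {a b} → R a b → f a < f b) →
    ∀ {x y} → Star R x y → x ≡ y ⊎ f x < f y
  star-increasing f inc ε = inj₁ refl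
  star-increasing f inc (r ◅ ry) with star-increasing f inc ry
  ... | inj₁ refl = inj₂ (inc r)
  ... | inj₂ lt   = inj₂ (NP.<-trans (inc r) lt)

-- In type A the graph ind(J) is a disjoint union of increasing chains.
module _ {n} {J : Sub n} where

  ind-increasing : ∀ {a b} → InInd J a b → toℕ a < toℕ b
  ind-increasing ind = proj₁ (proj₁ ind)

  -- each a has at most one ind-successor: of two roots e_a - e_b, e_a - e_c ∈ J the one with
  -- the smaller interval is lower, so only it can be minimal
  ind-successor-unique : Functional (InInd J)
  ind-successor-unique {a} {b} {c} ab ac with FP.<-cmp b c
  ... | tri< b<c _ _ = proj₂ (proj₂ ac a b (proj₁ ab) (rootLe-nested NP.≤-refl (NP.<⇒≤ b<c)))
  ... | tri≈ _ b≡c _ = b≡c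
  ... | tri> _ _ c<b = sym (proj₂ (proj₂ ab a c (proj₁ ac) (rootLe-nested NP.≤-refl (NP.<⇒≤ c<b))))

  ind-predecessor-unique : Functional (flip (InInd J))
  ind-predecessor-unique {a} {b} {c} ba ca with FP.<-cmp b c
  ... | tri< b<c _ _ = sym (proj₁ (proj₂ ba c a (proj₁ ca) (rootLe-nested (NP.<⇒≤ b<c) NP.≤-refl)))
  ... | tri≈ _ b≡c _ = b≡c
  ... | tri> _ _ c<b = proj₁ (proj₂ ca b a (proj₁ ba) (rootLe-nested (NP.<⇒≤ c<b) NP.≤-refl))

  onChain-trans : ∀ {x y z} → Comparable (InInd J) x y → Comparable (InInd J) y z → Comparable (InInd J) x z
  onChain-trans = comparable-trans ind-successor-unique ind-predecessor-unique

  chain-forward : ∀ {x y} → Comparable (InInd J) x y → toℕ x < toℕ y → Star (InInd J) x y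
  chain-forward (inj₁ xy) _ = xy
  chain-forward (inj₂ yx) x<y with star-increasing toℕ ind-increasing yx
  ... | inj₁ refl = ⊥-elim (NP.<-irrefl refl x<y)
  ... | inj₂ y<x  = ⊥-elim (NP.<-asym x<y y<x)

swap-left : ∀ {n} (a b : Fin n) → swap a b a ≡ b
swap-left a b with a ≟ a
... | yes _   = refl
... | no a≢a = ⊥-elim (a≢a refl)

swap-right : ∀ {n} (a b : Fin n) → swap a b b ≡ a
swap-right a b with b ≟ a
... | yes b≡a = b≡a
... | no _ with b ≟ b
...   | yes _   = refl
...   | no b≢b = ⊥-elim (b≢b refl)

swap-other : ∀ {n} {a b x : Fin n} → x ≢ a → x ≢ b → swap a b x ≡ x
swap-other {a = a} {b} {x} x≢a x≢b with x ≟ a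
... | yes x≡a = ⊥-elim (x≢a x≡a)
... | no _ with x ≟ b
...   | yes x≡b = ⊥-elim (x≢b x≡b)
...   | no _    = refl

swap-involutive : ∀ {n} (a b x : Fin n) → swap a b (swap a b x) ≡ x
swap-involutive a b x = by-cases (x ≟ a) (x ≟ b)
  where
  by-cases : Dec (x ≡ a) → Dec (x ≡ b) → swap a b (swap a b x) ≡ x
  by-cases (yes x≡a) _ = begin
    swap a b (swap a b x) ≡⟨ cong (swap a b) (trans (cong (swap a b) x≡a) (swap-left a b)) ⟩
    swap a b b            ≡⟨ trans (swap-right a b) (sym x≡a) ⟩
    x                     ∎
    where open ≡-Reasoning
  by-cases (no _) (yes x≡b) = begin
    swap a b (swap a b x) ≡⟨ cong (swap a b) (trans (cong (swap a b) x≡b) (swap-right a b)) ⟩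
    swap a b a            ≡⟨ trans (swap-left a b) (sym x≡b) ⟩
    x                     ∎
    where open ≡-Reasoning
  by-cases (no x≢a) (no x≢b) = trans (cong (swap a b) (swap-other x≢a x≢b)) (swap-other x≢a x≢b)

-- The parabolic subgroup W_J: closure properties, and every element moves points along chains.
module _ {n} {J : Sub n} where

  InW-cong : ∀ {σ τ} → InW J σ → (∀ x → σ x ≡ τ x) → InW J τ
  InW-cong (w-id id≗σ)            σ≗τ = w-id (λ x → trans (sym (σ≗τ x)) (id≗σ x))
  InW-cong (w-step a b ab σ′ σ≗) σ≗τ = w-step a b ab σ′ (λ x → trans (sym (σ≗τ x)) (σ≗ x))

  InW-swapˡ : ∀ {ρ a b} → InInd J a b → InW J ρ → InW J (swap a b ∘ ρ)
  InW-swapˡ ab (w-id ρ≗id)            = w-step _ _ ab (w-id (λ _ → refl)) (cong (swap _ _) ∘ ρ≗id)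
  InW-swapˡ ab (w-step c d cd ρ′ ρ≗) = w-step c d cd (InW-swapˡ ab ρ′) (cong (swap _ _) ∘ ρ≗)

  InW-∘ : ∀ {σ ρ} → InW J σ → InW J ρ → InW J (σ ∘ ρ)
  InW-∘         (w-id σ≗id)            ρ = InW-cong ρ (sym ∘ σ≗id ∘ _)
  InW-∘ {ρ = ρ} (w-step a b ab σ′ σ≗) wρ = InW-cong (InW-∘ σ′ (InW-swapˡ ab wρ)) (sym ∘ σ≗ ∘ ρ)

  -- every element of W_J has a left inverse in W_J (the generators are involutions)
  InW-inverse : ∀ {σ} → InW J σ → Σ (Fin n → Fin n) λ ι → InW J ι × (∀ x → ι (σ x) ≡ x)
  InW-inverse (w-id σ≗id) = (λ x → x) , w-id (λ _ → refl) , σ≗id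
  InW-inverse (w-step a b ab σ′ σ≗) with InW-inverse σ′
  ... | ι , wι , ισ≗id = swap a b ∘ ι , InW-swapˡ ab wι ,
        λ x → trans (cong (swap a b ∘ ι) (σ≗ x)) (trans (cong (swap a b) (ισ≗id _)) (swap-involutive a b x))

  swap-onChain : ∀ {a b} → InInd J a b → ∀ x → Comparable (InInd J) x (swap a b x)
  swap-onChain {a} {b} ab x = by-cases (x ≟ a) (x ≟ b)
    where
    by-cases : Dec (x ≡ a) → Dec (x ≡ b) → Comparable (InInd J) x (swap a b x)
    by-cases (yes x≡a) _ =
      subst₂ (Comparable _) (sym x≡a) (sym (trans (cong (swap a b) x≡a) (swap-left a b))) (inj₁ (ab ◅ ε))
    by-cases (no _) (yes x≡b) =
      subst₂ (Comparable _) (sym x≡b) (sym (trans (cong (swap a b) x≡b) (swap-right a b))) (inj₂ (ab ◅ ε))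
    by-cases (no x≢a) (no x≢b) = subst (Comparable _ x) (sym (swap-other x≢a x≢b)) comparable-refl

  InW-onChain : ∀ {σ} → InW J σ → ∀ x → Comparable (InInd J) x (σ x)
  InW-onChain (w-id σ≗id) x = subst (Comparable _ x) (sym (σ≗id x)) comparable-refl
  InW-onChain (w-step a b ab σ′ σ≗) x =
    subst (Comparable _ x) (sym (σ≗ x)) (onChain-trans (swap-onChain ab x) (InW-onChain σ′ (swap a b x)))

module _ {n} {J : Sub n} where

  sameCoset-refl : ∀ w → SameCoset J w w
  sameCoset-refl w = w-id (λ x → inverseˡ w)

  sameCoset-trans : ∀ u v w → SameCoset J u v → SameCoset J v w → SameCoset J u w
  sameCoset-trans u v w uv vw =
    InW-cong (InW-∘ uv vw) (λ x → cong (u ⟨$⟩ˡ_) (inverseʳ v))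

  sameCoset-sym : ∀ u v → SameCoset J u v → SameCoset J v u
  sameCoset-sym u v uv with InW-inverse uv
  ... | ι , wι , ι-left = InW-cong wι λ y → begin
    ι y                                    ≡⟨ cong ι (sym (σ-section y)) ⟩
    ι (u ⟨$⟩ˡ (v ⟨$⟩ʳ (v ⟨$⟩ˡ (u ⟨$⟩ʳ y)))) ≡⟨ ι-left _ ⟩
    v ⟨$⟩ˡ (u ⟨$⟩ʳ y)                      ∎
    where
    open ≡-Reasoning
    σ-section : ∀ y → u ⟨$⟩ˡ (v ⟨$⟩ʳ (v ⟨$⟩ˡ (u ⟨$⟩ʳ y))) ≡ y
    σ-section y = trans (cong (u ⟨$⟩ˡ_) (inverseʳ v)) (inverseˡ u)

  sameCoset-resp : ∀ w {v v′} → PermEq v v′ → SameCoset J w v → SameCoset J w v′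
  sameCoset-resp w v≗v′ wv = InW-cong wv (λ x → cong (w ⟨$⟩ˡ_) (v≗v′ x))

InW-mono : ∀ {n} {J J′ : Sub n} → (∀ a b → InInd J′ a b → InInd J a b) → ∀ {σ} → InW J′ σ → InW J σ
InW-mono J′⊆J (w-id σ≗id)            = w-id σ≗id
InW-mono J′⊆J (w-step a b ab σ′ σ≗) = w-step a b (J′⊆J a b ab) (InW-mono J′⊆J σ′) σ≗

sameSub-ind : ∀ {n} {J J′ : Sub n} → SameSub J J′ → ∀ a b → InInd J′ a b → InInd J a b
sameSub-ind same a b ((a<b , e) , minimal) =
  (a<b , trans (same a b a<b) e) , λ k l (k<l , e′) → minimal k l (k<l , trans (sym (same k l k<l)) e′)

Increasing : ∀ {n} → Sub n → Permutation′ n → Set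
Increasing {n} J u = ∀ (i j : Fin n) → InInd J i j → (u ⟨$⟩ʳ i) F.< (u ⟨$⟩ʳ j)

module _ {n} {J : Sub n} where

  increasing-forward : ∀ {u} → Increasing J u → ∀ {x y} → Star (InInd J) x y → toℕ x < toℕ y →
    toℕ (u ⟨$⟩ʳ x) < toℕ (u ⟨$⟩ʳ y)
  increasing-forward {u} inc path x<y with star-increasing (toℕ ∘ (u ⟨$⟩ʳ_)) (inc _ _) path
  ... | inj₁ refl = ⊥-elim (NP.<-irrefl refl x<y)
  ... | inj₂ ux<uy = ux<uy

  -- The point
  -- y = u⁻¹ v x lies on the chain of x; y < x is impossible (it would give v y < v x = u y = v y),
  -- and y ≥ x gives u x ≤ u y = v x.
  agree-below⇒≤ : ∀ u v → SameCoset J u v → Increasing J u → Increasing J v →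
    ∀ x → (∀ {y} → y F.< x → u ⟨$⟩ʳ y ≡ v ⟨$⟩ʳ y) → toℕ (u ⟨$⟩ʳ x) ≤ toℕ (v ⟨$⟩ʳ x)
  agree-below⇒≤ u v uv incU incV x agree with FP.<-cmp (u ⟨$⟩ˡ (v ⟨$⟩ʳ x)) x
  ... | tri< y<x _ _ = ⊥-elim (NP.<-irrefl (cong toℕ (trans (sym (agree y<x)) uy≡vx))
                         (increasing-forward {u = v} incV (chain-forward (comparable-sym (InW-onChain uv x)) y<x) y<x))
    where uy≡vx = inverseʳ u
  ... | tri≈ _ y≡x _ = NP.≤-reflexive (cong toℕ (trans (cong (u ⟨$⟩ʳ_) (sym y≡x)) (inverseʳ u)))
  ... | tri> _ _ x<y = NP.<⇒≤ (subst (λ z → toℕ (u ⟨$⟩ʳ x) < toℕ z) (inverseʳ u)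
                         (increasing-forward {u = u} incU (chain-forward (InW-onChain uv x) x<y) x<y))

  increasing-unique : ∀ u v → SameCoset J u v → Increasing J u → Increasing J v → PermEq u v
  increasing-unique u v uv incU incV = WF.All.wfRec <-wellFounded 0ℓ (λ x → u ⟨$⟩ʳ x ≡ v ⟨$⟩ʳ x) step
    where
    step : ∀ x → (∀ {y} → y F.< x → u ⟨$⟩ʳ y ≡ v ⟨$⟩ʳ y) → u ⟨$⟩ʳ x ≡ v ⟨$⟩ʳ x
    step x agree = FP.toℕ-injective (NP.≤-antisym
      (agree-below⇒≤ u v uv incU incV x agree)
      (agree-below⇒≤ v u (sameCoset-sym u v uv) incV incU x (λ y<x → sym (agree y<x))))

-- Part 6. Existence of the representative w′, by sorting along ind(J).

sum-update : ∀ {n} (f g : Fin n → ℕ) a → (∀ x → x ≢ a → f x ≡ g x) → sum f + g a ≡ sum g + f a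
sum-update {suc n} f g a f≗g = begin
  sum f + g a                          ≡⟨ cong (_+ g a) (sum-remove {i = a} f) ⟩
  f a + sum (f ∘ punchIn a) + g a      ≡⟨ cong (λ s → f a + s + g a) (sum-cong-≗ rest) ⟩
  f a + sum (g ∘ punchIn a) + g a      ≡⟨ exchange (f a) _ (g a) ⟩
  g a + sum (g ∘ punchIn a) + f a      ≡⟨ cong (_+ f a) (sym (sum-remove {i = a} g)) ⟩
  sum g + f a                          ∎
  where
  open ≡-Reasoning
  rest : ∀ x → f (punchIn a x) ≡ g (punchIn a x)
  rest x = f≗g (punchIn a x) (FP.punchInᵢ≢i a x)
  exchange : ∀ p s q → p + s + q ≡ q + s + p
  exchange = ℕ-Solver.solve-∀

sum-update₂ : ∀ {n} (f g : Fin n → ℕ) a b → a ≢ b → (∀ x → x ≢ a → x ≢ b → f x ≡ g x) →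
  sum f + (g a + g b) ≡ sum g + (f a + f b)
sum-update₂ f g a b a≢b f≗g = begin
  sum f + (g a + g b)  ≡⟨ sym (NP.+-assoc (sum f) _ _) ⟩
  sum f + g a + g b    ≡⟨ cong (_+ g b) (trans (cong (sum f +_) (sym h-at-a)) (sum-update f h a f≗h)) ⟩
  sum h + f a + g b    ≡⟨ NP.+-assoc (sum h) _ _ ⟩
  sum h + (f a + g b)  ≡⟨ cong (sum h +_) (NP.+-comm (f a) (g b)) ⟩
  sum h + (g b + f a)  ≡⟨ sym (NP.+-assoc (sum h) _ _) ⟩
  sum h + g b + f a    ≡⟨ cong (_+ f a) (trans (sum-update h g b h≗g) (cong (sum g +_) h-at-b)) ⟩
  sum g + f b + f a    ≡⟨ trans (NP.+-assoc (sum g) _ _) (cong (sum g +_) (NP.+-comm (f b) (f a))) ⟩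
  sum g + (f a + f b)  ∎
  where
  open ≡-Reasoning
  h = updateAt f a (const (g a))
  h-at-a : h a ≡ g a
  h-at-a = VecP.updateAt-updates a f
  h-at-b : h b ≡ f b
  h-at-b = VecP.updateAt-minimal b a f (a≢b ∘ sym)
  f≗h : ∀ x → x ≢ a → f x ≡ h x
  f≗h x x≢a = sym (VecP.updateAt-minimal x a f x≢a)
  h≗g : ∀ x → x ≢ b → h x ≡ g x
  h≗g x x≢b with x ≟ a
  ... | yes refl = h-at-a
  ... | no x≢a   = trans (sym (f≗h x x≢a)) (f≗g x x≢a x≢b)

rearrangement : ∀ a b x y → a < b → y < x → a * x + b * y < a * y + b * x
rearrangement a b x y a<b y<x with NP.m≤n⇒∃[o]m+o≡n a<b | NP.m≤n⇒∃[o]m+o≡n y<x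
... | p , refl | q , refl = subst (a * suc (y + q) + suc (a + p) * y <_) (expand a p y q) (NP.m<m+n _ (s≤s z≤n))
  where
  expand : ∀ a p y q → a * suc (y + q) + suc (a + p) * y + suc p * suc q ≡ a * y + suc (a + p) * suc (y + q)
  expand = ℕ-Solver.solve-∀

swapPositions : ∀ {n} → Permutation′ n → Fin n → Fin n → Permutation′ n
swapPositions u a b = permutation (λ x → u ⟨$⟩ʳ swap a b x) (λ y → swap a b (u ⟨$⟩ˡ y))
  (λ y → trans (cong (u ⟨$⟩ʳ_) (swap-involutive a b _)) (inverseʳ u))
  (λ x → trans (cong (swap a b) (inverseˡ u)) (swap-involutive a b x))

-- The potential Σₓ x · u(x) of a permutation; it is bounded by n³
-- and strictly increases when an inversion is undone.
potential : ∀ {n} → Permutation′ n → ℕ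
potential u = sum (λ x → toℕ x * toℕ (u ⟨$⟩ʳ x))

sum-≤ : ∀ {n} (f : Fin n → ℕ) c → (∀ x → f x ≤ c) → sum f ≤ n * c
sum-≤ {zero}  f c f≤c = z≤n
sum-≤ {suc n} f c f≤c = NP.+-mono-≤ (f≤c F.zero) (sum-≤ (f ∘ F.suc) c (f≤c ∘ F.suc))

potential-≤ : ∀ {n} (u : Permutation′ n) → potential u ≤ n * (n * n)
potential-≤ {n} u = sum-≤ _ (n * n) λ x → NP.*-mono-≤ (NP.<⇒≤ (FP.toℕ<n x)) (NP.<⇒≤ (FP.toℕ<n (u ⟨$⟩ʳ x)))

potential-swap : ∀ {n} (u : Permutation′ n) a b → a F.< b → (u ⟨$⟩ʳ b) F.< (u ⟨$⟩ʳ a) →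
  potential u < potential (swapPositions u a b)
potential-swap {n} u a b a<b inverted =
  NP.+-cancelʳ-< (f a + f b) (sum f) (sum g) (subst (sum f + (f a + f b) <_) sums (NP.+-monoʳ-< (sum f) gain))
  where
  f g : Fin n → ℕ
  f x = toℕ x * toℕ (u ⟨$⟩ʳ x)
  g x = toℕ x * toℕ (u ⟨$⟩ʳ swap a b x)
  a≢b : a ≢ b
  a≢b a≡b = NP.<-irrefl (cong toℕ a≡b) a<b
  sums : sum f + (g a + g b) ≡ sum g + (f a + f b)
  sums = sum-update₂ f g a b a≢b λ x x≢a x≢b → cong (λ z → toℕ x * toℕ (u ⟨$⟩ʳ z)) (sym (swap-other x≢a x≢b))
  gain : f a + f b < g a + g b
  gain = subst₂ (λ y z → f a + f b < toℕ a * toℕ (u ⟨$⟩ʳ y) + toℕ b * toℕ (u ⟨$⟩ʳ z))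
           (sym (swap-left a b)) (sym (swap-right a b))
           (rearrangement (toℕ a) (toℕ b) (toℕ (u ⟨$⟩ʳ a)) (toℕ (u ⟨$⟩ʳ b)) a<b inverted)

-- Existence of the representative w′ ∈ w W_J with w′(ind J) ⊆ Φ⁺: starting from w, undo
-- inverted valleys of D(J) (= inverted roots of ind J) one at a time.  Each step multiplies
-- by a generator of W_J and raises the potential, so at most n³ steps are needed.
module _ {n} (J : Sub n) (filter : IsFilter J) (w : Permutation′ n) where
  private
    D  = proj₁ (DJ-exists J filter)
    dj = proj₂ (DJ-exists J filter)
    open DecMembership (ProductP.≡-dec NP._≟_ NP._≟_) using (_∈?_)

  Inversion : Permutation′ n → Set
  Inversion u = ∃ λ a → ∃ λ b → (toℕ a , toℕ b) ∈ valleys D 0 0 × (u ⟨$⟩ʳ b) F.< (u ⟨$⟩ʳ a)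

  inversion? : ∀ u → Dec (Inversion u)
  inversion? u = FP.any? λ a → FP.any? λ b → ((toℕ a , toℕ b) ∈? valleys D 0 0) ×-dec ((u ⟨$⟩ʳ b) F.<? (u ⟨$⟩ʳ a))

  no-inversion⇒increasing : ∀ {u} → ¬ Inversion u → Increasing J u
  no-inversion⇒increasing {u} none i j ind with FP.<-cmp (u ⟨$⟩ʳ i) (u ⟨$⟩ʳ j)
  ... | tri< ui<uj _ _ = ui<uj
  ... | tri> _ _ uj<ui = ⊥-elim (none (i , j , ind⇒valley dj i j ind , uj<ui))
  ... | tri≈ _ ui≡uj _ = ⊥-elim (NP.<-irrefl (cong toℕ i≡j) (ind-increasing ind))
    where i≡j = trans (sym (inverseˡ u)) (trans (cong (u ⟨$⟩ˡ_) ui≡uj) (inverseˡ u))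

  -- the fuel exceeds n³ minus the potential of u, so it bounds the number of remaining steps
  sort : ∀ fuel u → n * (n * n) < potential u + fuel → SameCoset J w u → Σ (Permutation′ n) (IsRep J w)
  sort zero u enough _ =
    ⊥-elim (NP.<⇒≱ (subst (n * (n * n) <_) (NP.+-identityʳ _) enough) (potential-≤ u))
  sort (suc fuel) u enough wu with inversion? u
  ... | no none = u , wu , no-inversion⇒increasing {u} none
  ... | yes (a , b , valley , inverted) = sort fuel (swapPositions u a b) still-enough
        (w-step a b (valley⇒ind dj a b valley) wu (λ _ → refl))
    where
    raised = potential-swap u a b (ind-increasing (valley⇒ind dj a b valley)) inverted
    still-enough : n * (n * n) < potential (swapPositions u a b) + fuel
    still-enough = NP.<-≤-trans enough
      (subst (_≤ potential (swapPositions u a b) + fuel) (sym (NP.+-suc (potential u) fuel)) (NP.+-monoˡ-≤ fuel raised))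

  representative-exists : Σ (Permutation′ n) (IsRep J w)
  representative-exists = sort (suc (n * (n * n))) w (NP.m≤n+m _ (potential w)) (sameCoset-refl w)

-- Part 7. The bijection ε.

representative-unique : ∀ {n} (J : Sub n) (w u v : Permutation′ n) → IsRep J w u → IsRep J w v → PermEq u v
representative-unique J w u v (wu , incU) (wv , incV) =
  increasing-unique u v (sameCoset-trans u w v (sameCoset-sym w u wu) wv) incU incV

representative-move : ∀ {n} (J : Sub n) (w₁ w₂ v : Permutation′ n) →
  SameCoset J w₁ w₂ → IsRep J w₁ v → IsRep J w₂ v
representative-move J w₁ w₂ v w₁w₂ (w₁v , incV) = sameCoset-trans w₂ w₁ v (sameCoset-sym w₁ w₂ w₁w₂) w₁v , incV

representative-injective : ∀ {n} {J J′ : Sub n} → SameSub J J′ → ∀ (w₁ w₂ v₁ v₂ : Permutation′ n) →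
  IsRep J w₁ v₁ → IsRep J′ w₂ v₂ → PermEq v₁ v₂ → SameCoset J w₁ w₂
representative-injective same w₁ w₂ v₁ v₂ (w₁v₁ , _) (w₂v₂ , _) v₁≗v₂ =
  sameCoset-trans w₁ v₂ w₂ (sameCoset-resp w₁ {v₁} {v₂} v₁≗v₂ w₁v₁)
    (sameCoset-sym w₂ v₂ (InW-mono (sameSub-ind same) w₂v₂))

DJ-injective : ∀ {n} {J₁ J₂ : Sub n} {D} → IsDJ J₁ D → IsDJ J₂ D → SameSub J₁ J₂
DJ-injective (_ , box₁) (_ , box₂) i j i<j = ⇔→≡ (mk⇔
  (λ e → proj₂ (proj₁ (box₂ i j i<j) (proj₂ (box₁ i j i<j) (i<j , e))))
  (λ e → proj₂ (proj₁ (box₁ i j i<j) (proj₂ (box₂ i j i<j) (i<j , e)))))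

lemma16p1 : (n : ℕ) →
    ((J : Sub n) → IsFilter J → Σ (List Step) (λ D → IsDJ J D)) ×
    ((J : Sub n) (D D′ : List Step) → IsDJ J D → IsDJ J D′ → D ≡ D′) ×
    ((J : Sub n) (w : Permutation′ n) → IsFilter J → Σ (Permutation′ n) (λ w′ → IsRep J w w′)) ×
    ((J : Sub n) (w w′ w″ : Permutation′ n) → IsFilter J → IsRep J w w′ → IsRep J w w″ → PermEq w′ w″) ×
    ((J : Sub n) (w₁ w₂ v : Permutation′ n) → IsFilter J → SameCoset J w₁ w₂ → IsRep J w₁ v → IsRep J w₂ v) ×
    ((J : Sub n) (w w′ : Permutation′ n) (D : List Step) → IsFilter J → IsRep J w w′ → IsDJ J D → InDn w′ D) ×
    ((J₁ J₂ : Sub n) (w₁ w₂ v₁ v₂ : Permutation′ n) (D₁ D₂ : List Step) →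
      IsFilter J₁ → IsFilter J₂ → IsRep J₁ w₁ v₁ → IsRep J₂ w₂ v₂ → IsDJ J₁ D₁ → IsDJ J₂ D₂ →
      PermEq v₁ v₂ → D₁ ≡ D₂ → SameSub J₁ J₂ × SameCoset J₁ w₁ w₂) ×
    ((w : Permutation′ n) (D : List Step) → InDn w D →
      Σ (Sub n) (λ J → Σ (Permutation′ n) (λ u → Σ (Permutation′ n) (λ v →
        IsFilter J × IsRep J u v × PermEq v w × IsDJ J D))))
lemma16p1 n =
  DJ-exists ,
  DJ-unique ,
  (λ J w filter → representative-exists J filter w) ,
  (λ J w w′ w″ _ → representative-unique J w w′ w″) ,
  (λ J w₁ w₂ v _ → representative-move J w₁ w₂ v) ,
  -- ε lands in 𝒟ₙ: the valleys of D(J) are ind(J), on which w′ increases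
  (λ J _ _ D _ (_ , inc) dj → proj₁ dj , λ i j valley → inc i j (valley⇒ind dj i j valley)) ,
  -- ε is injective: D(J) determines J, and then w′ determines the coset w W_J
  (λ { J₁ J₂ w₁ w₂ v₁ v₂ D₁ _ _ _ rep₁ rep₂ dj₁ dj₂ v₁≗v₂ refl →
       let same = DJ-injective dj₁ dj₂ in same , representative-injective same w₁ w₂ v₁ v₂ rep₁ rep₂ v₁≗v₂ }) ,
  -- ε is surjective: (w , D) is the image of [w , J] for J the boxes above D
  (λ w D (dyck , increasing) → let dj = boxesAbove-DJ dyck in
     boxesAbove D , w , w , boxesAbove-filter dyck ,
     (sameCoset-refl w , λ i j ind → increasing i j (ind⇒valley dj i j ind)) , (λ _ → refl) , dj)
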